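{- For $q\ge2$, $M(q,i)=\min_{0\le j\le i}\max(M(q-1,j-1),R_{ji})$. For fixed $q\ge2$, let $j(i)$ be the largest $j\in\{0,\dots,i\}$ attaining this minimum. Then $j(i)\ge j(i-1)$, i.e., incrementing $i$ cannot decrease the minimizing $j$.
   Context: $P$ is a path with vertices at coordinates $x_0<\dots<x_n$; $\tau>0$; $k\ge1$ fixed. Vertex $x_i$ has weight interval $[w_i^-,w_i^+]$, $0<w_i^-\le w_i^+$; a scenario $s$ assigns $w_i(s)\in[w_i^-,w_i^+]$, $\mathcal S$ the set of scenarios. For a subpath $Q=\{x_l,\dots,x_r\}$ and sink $y=x_t\in Q$: $\Theta_L(Q,y,s)=\max_{l\le i<t}\{(x_t-x_i)\tau+\sum_{j=l}^i w_j(s)\}$, $\Theta_R(Q,y,s)=\max_{t<i\le r}\{(x_i-x_t)\tau+\sum_{j=i}^r w_j(s)\}$ (empty maxima $0$), $\Theta^1=\max(\Theta_L,\Theta_R)$. A $k$-partition with sinks: consecutive subpaths $P_1,\dots,P_k$ partitioning the vertices with sinks $y_i\in P_i$; $\Theta^k=\max_i\Theta^1(P_i,y_i,s)$, $\Theta^k_{\rm opt}(P,s)$ its minimum; regret $=\Theta^k-\Theta^k_{\rm opt}$; a worst-case scenario maximizes regret over $\mathcal S$; dominant part $P_d$, $d$ smallest index maximizing $\Theta^1(P_i,y_i,s)$. Left-/right-dominant sub-scenario on $\{x_l,\dots,x_r\}$: for some $l\le i\le r$, $w_j=w_j^+$ (resp. $w_j^-$) for $l\le j<i$ and $w_j=w_j^-$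 (resp. $w_j^+$) for $i\le j\le r$. $\mathcal S^*$: all scenarios that, for some $k$-partition with sinks, are worst-case scenarios for it with $w_i=w_i^-$ off the dominant part and left- or right-dominant sub-scenario in it. For $Q_{lr}=\{x_l,\dots,x_r\}$: $R_{lr}(s,x_t)=\Theta^1(Q_{lr},x_t,s)-\Theta^k_{\rm opt}(P,s)$, $R_{lr}(x_t)=\max_{s\in\mathcal S^*}R_{lr}(s,x_t)$, $R_{lr}=\min_{l\le t\le r}R_{lr}(x_t)$. $M(q,i)$ is the minimum, over partitions of $\{x_0,\dots,x_i\}$ into at most $q$ consecutive subpaths $\{x_{l_1},\dots,x_{r_1}\},\dots$, of $\max_j R_{l_jr_j}$, with $M(q-1,-1)=-\infty$ for the empty prefix.
   Formalization: The vertex coordinates, τ, the endpoints of the weight intervals and the weights assigned by every scenario all take values in ℚ. -}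

module Defs where

open import Data.Nat as ℕ using (ℕ; zero; suc; _∸_; pred)
open import Data.Rational as ℚ using (ℚ; 0ℚ)
open import Data.Product using (_×_; _,_; Σ; ∃; ∃-syntax)
open import Data.Sum using (_⊎_)
open import Data.List using (List; []; _∷_; foldr; length)
open import Data.Maybe using (Maybe; just; nothing)
open import Relation.Binary.PropositionalEquality using (_≡_; _≢_)
open import Relation.Nullary using (¬_)

-- ℚ extended with -∞ (used for M(q-1,-1) = -∞ and for maxima of
-- possibly empty lists of R-values).

data ℚ₋∞ : Set where
  -∞  : ℚ₋∞
  fin : ℚ → ℚ₋∞

_⊔∞_ : ℚ₋∞ → ℚ₋∞ → ℚ₋∞
-∞    ⊔∞ b     = b
a     ⊔∞ -∞    = a
fin a ⊔∞ fin b = fin (a ℚ.⊔ b)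

_⊓∞_ : ℚ₋∞ → ℚ₋∞ → ℚ₋∞
-∞    ⊓∞ b     = -∞
a     ⊓∞ -∞    = -∞
fin a ⊓∞ fin b = fin (a ℚ.⊓ b)

data _≤∞_ : ℚ₋∞ → ℚ₋∞ → Set where
  -∞≤   : ∀ {b} → -∞ ≤∞ b
  fin≤  : ∀ {a b} → a ℚ.≤ b → fin a ≤∞ fin b

minUpTo : (ℕ → ℚ₋∞) → ℕ → ℚ₋∞
minUpTo g zero    = g zero
minUpTo g (suc i) = minUpTo g i ⊓∞ g (suc i)

IsLargestArgmin : (ℕ → ℚ₋∞) → ℕ → ℕ → Set
IsLargestArgmin g i j =
  j ℕ.≤ i × g j ≡ minUpTo g i ×
  (∀ j' → j ℕ.< j' → j' ℕ.≤ i → g j' ≢ minUpTo g i)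

nth : {A : Set} → List A → ℕ → Maybe A
nth []       _       = nothing
nth (a ∷ as) zero    = just a
nth (a ∷ as) (suc d) = nth as d

sumCount : (ℕ → ℚ) → ℕ → ℕ → ℚ
sumCount s a zero    = 0ℚ
sumCount s a (suc c) = sumCount s a c ℚ.+ s (a ℕ.+ c)

sumRange : (ℕ → ℚ) → ℕ → ℕ → ℚ
sumRange s a b = sumCount s a (suc b ∸ a)

maxRange : (ℕ → ℚ) → ℕ → ℕ → ℚ
maxRange f a zero    = 0ℚ
maxRange f a (suc c) = maxRange f a c ℚ.⊔ f (a ℕ.+ c)

-- The problem instance: vertices x_0 < … < x_n (given by x : ℕ → ℚ,
-- only indices ≤ n matter), τ, k, weight intervals [wm i, wp i].

module Setup (n k : ℕ) (x : ℕ → ℚ) (τ : ℚ) (wm wp : ℕ → ℚ) where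

  Scenario : Set
  Scenario = ℕ → ℚ

  IsScenario : Scenario → Set
  IsScenario s = ∀ i → i ℕ.≤ n → (wm i ℚ.≤ s i × s i ℚ.≤ wp i)

  ΘL : ℕ → ℕ → Scenario → ℚ
  ΘL l t s = maxRange (λ i → ((x t ℚ.- x i) ℚ.* τ) ℚ.+ sumRange s l i) l (t ∸ l)

  ΘR : ℕ → ℕ → Scenario → ℚ
  ΘR t r s = maxRange (λ i → ((x i ℚ.- x t) ℚ.* τ) ℚ.+ sumRange s i r) (suc t) (r ∸ t)

  -- a part with sink: (l , r , t) = subpath {x_l..x_r} with sink x_t
  Part : Set
  Part = ℕ × ℕ × ℕ

  Θ1 : Part → Scenario → ℚ
  Θ1 (l , r , t) s = ΘL l t s ℚ.⊔ ΘR t r s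

  data PartsFrom : ℕ → List Part → Set where
    lastPart : ∀ {l t} → l ℕ.≤ t → t ℕ.≤ n → PartsFrom l ((l , n , t) ∷ [])
    consPart : ∀ {l r t ps} → l ℕ.≤ t → t ℕ.≤ r → r ℕ.< n →
               PartsFrom (suc r) ps → PartsFrom l ((l , r , t) ∷ ps)

  IsKPartition : List Part → Set
  IsKPartition ps = PartsFrom 0 ps × length ps ≡ k

  -- Θ^k (all Θ^1 values are ≥ 0, so base value 0 gives the maximum)
  Θk : List Part → Scenario → ℚ
  Θk ps s = foldr (λ p acc → Θ1 p s ℚ.⊔ acc) 0ℚ ps

  IsOpt : Scenario → ℚ → Set
  IsOpt s v = (∃[ ps ] (IsKPartition ps × Θk ps s ≡ v)) ×
              (∀ ps → IsKPartition ps → v ℚ.≤ Θk ps s)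

  -- the remaining definitions use a function opt with IsOpt s (opt s)
  module WithOpt (opt : Scenario → ℚ) where

    regret : List Part → Scenario → ℚ
    regret ps s = Θk ps s ℚ.- opt s

    IsWorstCase : List Part → Scenario → Set
    IsWorstCase ps s = IsScenario s ×
      (∀ s' → IsScenario s' → regret ps s' ℚ.≤ regret ps s)

    IsDominant : List Part → Scenario → ℕ → Part → Set
    IsDominant ps s d p = nth ps d ≡ just p × Θ1 p s ≡ Θk ps s ×
      (∀ d' p' → d' ℕ.< d → nth ps d' ≡ just p' → Θ1 p' s ℚ.< Θk ps s)

    LeftDominant : ℕ → ℕ → Scenario → Set
    LeftDominant l r s = ∃[ i ] (l ℕ.≤ i × i ℕ.≤ r ×
      (∀ j → l ℕ.≤ j → j ℕ.< i → s j ≡ wp j) ×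
      (∀ j → i ℕ.≤ j → j ℕ.≤ r → s j ≡ wm j))

    RightDominant : ℕ → ℕ → Scenario → Set
    RightDominant l r s = ∃[ i ] (l ℕ.≤ i × i ℕ.≤ r ×
      (∀ j → l ℕ.≤ j → j ℕ.< i → s j ≡ wm j) ×
      (∀ j → i ℕ.≤ j → j ℕ.≤ r → s j ≡ wp j))

    InSstar : Scenario → Set
    InSstar s = ∃[ ps ] (IsKPartition ps × IsWorstCase ps s ×
      ∃[ d ] ∃[ l ] ∃[ r ] ∃[ t ] (IsDominant ps s d (l , r , t) ×
        (∀ i → i ℕ.≤ n → (i ℕ.< l ⊎ r ℕ.< i) → s i ≡ wm i) ×
        (LeftDominant l r s ⊎ RightDominant l r s)))

    Rlrs : ℕ → ℕ → Scenario → ℕ → ℚ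
    Rlrs l r s t = Θ1 (l , r , t) s ℚ.- opt s

    IsRlrt : ℕ → ℕ → ℕ → ℚ → Set
    IsRlrt l r t v = (∃[ s ] (InSstar s × Rlrs l r s t ≡ v)) ×
                     (∀ s → InSstar s → Rlrs l r s t ℚ.≤ v)

    IsRlr : ℕ → ℕ → ℚ → Set
    IsRlr l r v = (∃[ t ] (l ℕ.≤ t × t ℕ.≤ r × IsRlrt l r t v)) ×
                  (∀ t u → l ℕ.≤ t → t ℕ.≤ r → IsRlrt l r t u → v ℚ.≤ u)

    data SegsFrom : ℕ → ℕ → List (ℕ × ℕ) → Set where
      noSeg   : ∀ {a} → SegsFrom a a []
      consSeg : ∀ {a r b segs} → a ℕ.≤ r → SegsFrom (suc r) b segs →
                SegsFrom a b ((a , r) ∷ segs)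

    maxR : (ℕ → ℕ → ℚ) → List (ℕ × ℕ) → ℚ₋∞
    maxR R segs = foldr (λ { (l , r) acc → fin (R l r) ⊔∞ acc }) -∞ segs

    -- v = M(q, m-1): min over partitions of the prefix {x_0,…,x_{m-1}}
    -- into at most q consecutive subpaths of max_j R_{l_j r_j}
    IsM : (ℕ → ℕ → ℚ) → ℕ → ℕ → ℚ₋∞ → Set
    IsM R q m v =
      (∃[ segs ] (SegsFrom 0 m segs × length segs ℕ.≤ q × maxR R segs ≡ v)) ×
      (∀ segs → SegsFrom 0 m segs → length segs ℕ.≤ q → v ≤∞ maxR R segs)

-- The recurrence holds because a partition of {x₀,…,xᵢ} into at most q parts splits into its
-- last part {xⱼ,…,xᵢ} and a partition of {x₀,…,x_{j-1}} into at most q - 1 parts.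
-- Monotonicity of the largest minimiser is an exchange argument resting on one property of R:
-- R_{lr} ≤ R_{l'r'} whenever {x_l,…,x_r} ⊆ {x_l',…,x_r'}. Clamping the sink of the larger
-- subpath into [x_l, x_r] lengthens no travel distance, and partial sums of nonnegative weights
-- only shrink on the smaller subpath, so Θ¹ and hence R_{lr}(s, ·) decrease scenario by scenario. Turning this into an
-- inequality between R-values needs the maximum over 𝒮* defining R_{lr}(x_t) to be attained;
-- it is, because scenarios in 𝒮* take only the values w⁻ and w⁺ and R_{lr}(s, x_t) depends only
-- on s restricted to {0,…,n}. Constructively this maximum exists only under double negation,
-- which suffices since the conclusion j(i-1) ≤ j(i) is decidable.

module Submission where

open import Defs
import Data.Rational.Properties as ℚP
open import Algebra.Properties.AbelianGroup ℚP.+-0-abelianGroup using (xyx⁻¹≈y)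
open import Data.Bool using (Bool; true; false; if_then_else_)
open import Data.Empty using (⊥-elim)
open import Data.List using (List; []; _∷_; [_]; _++_; _∷ʳ_; map; length)
open import Data.List.Properties using (length-++)
open import Data.List.Relation.Unary.All using (All; []; _∷_; lookupAny)
import Data.List.Relation.Unary.All as All
open import Data.List.Relation.Unary.All.Properties using (¬Any⇒All¬)
open import Data.List.Relation.Unary.Any using (Any; here; there)
import Data.List.Relation.Unary.Any as Any
open import Data.List.Relation.Unary.Any.Properties using (map⁺; ++⁺ˡ; ++⁺ʳ)
open import Data.Nat as ℕ using (ℕ; zero; suc; pred; _≤_; _<_; _∸_; z≤n; s≤s)
import Data.Nat.Properties as ℕP
open import Data.Product using (_×_; _,_; ∃-syntax; proj₁; proj₂)
open import Data.Rational as ℚ using (ℚ; 0ℚ) renaming (_<_ to _<ℚ_; _≤_ to _≤ℚ_)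
open import Data.Sum using (_⊎_; inj₁; inj₂)
open import Effect.Monad using (RawMonad)
open import Level using (0ℓ)
open import Function using (_∘_; const)
open import Relation.Binary.PropositionalEquality
  using (_≡_; refl; sym; trans; cong; cong₂; subst; module ≡-Reasoning)
open import Relation.Nullary using (¬_; Dec; yes; no; does)
open import Relation.Nullary.Decidable using (decidable-stable; ¬¬-excluded-middle)
open import Relation.Nullary.Negation using (¬¬-Monad)
open RawMonad (¬¬-Monad {a = 0ℓ}) using (pure; _>>=_)

≤∞-refl : ∀ {a} → a ≤∞ a
≤∞-refl { -∞}   = -∞≤
≤∞-refl {fin a} = fin≤ ℚP.≤-refl

≤∞-reflexive : ∀ {a b} → a ≡ b → a ≤∞ b
≤∞-reflexive refl = ≤∞-refl

≤∞-trans : ∀ {a b c} → a ≤∞ b → b ≤∞ c → a ≤∞ c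
≤∞-trans -∞≤      _        = -∞≤
≤∞-trans (fin≤ p) (fin≤ q) = fin≤ (ℚP.≤-trans p q)

≤∞-antisym : ∀ {a b} → a ≤∞ b → b ≤∞ a → a ≡ b
≤∞-antisym -∞≤      -∞≤      = refl
≤∞-antisym (fin≤ p) (fin≤ q) = cong fin (ℚP.≤-antisym p q)

⊔∞-upperˡ : ∀ a b → a ≤∞ (a ⊔∞ b)
⊔∞-upperˡ -∞      b       = -∞≤
⊔∞-upperˡ (fin a) -∞      = ≤∞-refl
⊔∞-upperˡ (fin a) (fin b) = fin≤ (ℚP.p≤p⊔q a b)

⊔∞-upperʳ : ∀ a b → b ≤∞ (a ⊔∞ b)
⊔∞-upperʳ -∞      b       = ≤∞-refl
⊔∞-upperʳ (fin a) -∞      = -∞≤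
⊔∞-upperʳ (fin a) (fin b) = fin≤ (ℚP.p≤q⊔p a b)

⊔∞-lub : ∀ {a b c} → a ≤∞ c → b ≤∞ c → (a ⊔∞ b) ≤∞ c
⊔∞-lub { -∞}            _        q        = q
⊔∞-lub {fin a} { -∞}    p        _        = p
⊔∞-lub {fin a} {fin b}  (fin≤ p) (fin≤ q) = fin≤ (ℚP.⊔-lub p q)

⊔∞-monoʳ-fin : ∀ a {p q} → p ≤ℚ q → (a ⊔∞ fin p) ≤∞ (a ⊔∞ fin q)
⊔∞-monoʳ-fin -∞      p≤q = fin≤ p≤q
⊔∞-monoʳ-fin (fin a) p≤q = fin≤ (ℚP.⊔-monoʳ-≤ a p≤q)

⊔∞-assoc : ∀ a b c → (a ⊔∞ b) ⊔∞ c ≡ a ⊔∞ (b ⊔∞ c)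
⊔∞-assoc -∞      b       c       = refl
⊔∞-assoc (fin a) -∞      c       = refl
⊔∞-assoc (fin a) (fin b) -∞      = refl
⊔∞-assoc (fin a) (fin b) (fin c) = cong fin (ℚP.⊔-assoc a b c)

⊓∞-lowerˡ : ∀ a b → (a ⊓∞ b) ≤∞ a
⊓∞-lowerˡ -∞      b       = -∞≤
⊓∞-lowerˡ (fin a) -∞      = -∞≤
⊓∞-lowerˡ (fin a) (fin b) = fin≤ (ℚP.p⊓q≤p a b)

⊓∞-lowerʳ : ∀ a b → (a ⊓∞ b) ≤∞ b
⊓∞-lowerʳ -∞      b       = -∞≤
⊓∞-lowerʳ (fin a) -∞      = -∞≤
⊓∞-lowerʳ (fin a) (fin b) = fin≤ (ℚP.p⊓q≤q a b)

⊓∞-sel : ∀ a b → (a ⊓∞ b ≡ a) ⊎ (a ⊓∞ b ≡ b)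
⊓∞-sel -∞      b       = inj₁ refl
⊓∞-sel (fin a) -∞      = inj₂ refl
⊓∞-sel (fin a) (fin b) with ℚP.⊓-sel a b
... | inj₁ e = inj₁ (cong fin e)
... | inj₂ e = inj₂ (cong fin e)

minUpTo-≤ : ∀ g {i j} → j ≤ i → minUpTo g i ≤∞ g j
minUpTo-≤ g {zero}  z≤n = ≤∞-refl
minUpTo-≤ g {suc i} j≤1+i with ℕP.m≤n⇒m<n∨m≡n j≤1+i
... | inj₁ (s≤s j≤i) = ≤∞-trans (⊓∞-lowerˡ (minUpTo g i) (g (suc i))) (minUpTo-≤ g j≤i)
... | inj₂ refl       = ⊓∞-lowerʳ (minUpTo g i) (g (suc i))

minUpTo-attained : ∀ g i → ∃[ j ] (j ≤ i × minUpTo g i ≡ g j)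
minUpTo-attained g zero    = zero , z≤n , refl
minUpTo-attained g (suc i) with ⊓∞-sel (minUpTo g i) (g (suc i))
... | inj₂ e = suc i , ℕP.≤-refl , e
... | inj₁ e with minUpTo-attained g i
...   | j , j≤i , e′ = j , ℕP.m≤n⇒m≤1+n j≤i , trans e e′

length-∷ʳ : ∀ {A : Set} (xs : List A) y → length (xs ∷ʳ y) ≡ suc (length xs)
length-∷ʳ xs y = trans (length-++ xs) (ℕP.+-comm (length xs) 1)

module _ (n k : ℕ) (x : ℕ → ℚ) (τ : ℚ) (wm wp : ℕ → ℚ) (opt : (ℕ → ℚ) → ℚ)
         (R : ℕ → ℕ → ℚ) where
  open Setup.WithOpt n k x τ wm wp opt

  SegsFrom-∷ʳ : ∀ {a j i segs} → SegsFrom a j segs → j ≤ i →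
                SegsFrom a (suc i) (segs ∷ʳ (j , i))
  SegsFrom-∷ʳ noSeg              j≤i = consSeg j≤i noSeg
  SegsFrom-∷ʳ (consSeg a≤r rest) j≤i = consSeg a≤r (SegsFrom-∷ʳ rest j≤i)

  SegsFrom-unsnoc : ∀ {a b seg segs} → SegsFrom a (suc b) (seg ∷ segs) →
    ∃[ init ] ∃[ j ] (seg ∷ segs ≡ init ∷ʳ (j , b) × SegsFrom a j init × j ≤ b)
  SegsFrom-unsnoc (consSeg {a = a} a≤b noSeg) = [] , a , refl , noSeg , a≤b
  SegsFrom-unsnoc (consSeg {a = a} {r = r} a≤r rest@(consSeg _ _))
    with SegsFrom-unsnoc rest
  ... | init , j , e , segs , j≤b =
    (a , r) ∷ init , j , cong ((a , r) ∷_) e , consSeg a≤r segs , j≤b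

  maxR-∷ʳ : ∀ segs j i → maxR R (segs ∷ʳ (j , i)) ≡ maxR R segs ⊔∞ fin (R j i)
  maxR-∷ʳ []              j i = refl
  maxR-∷ʳ ((l , r) ∷ segs) j i = trans (cong (fin (R l r) ⊔∞_) (maxR-∷ʳ segs j i))
                                      (sym (⊔∞-assoc (fin (R l r)) (maxR R segs) (fin (R j i))))

  M-recurrence : (M : ℕ → ℕ → ℚ₋∞) →
    (∀ q m → 1 ≤ q → m ≤ suc n → IsM R q m (M q m)) →
    ∀ {q i} → 1 ≤ q → i ≤ n → M (suc q) (suc i) ≡ minUpTo (λ j → M q j ⊔∞ fin (R j i)) i
  M-recurrence M isM {q} {i} 1≤q i≤n = ≤∞-antisym M≤min min≤M
    where
    g : ℕ → ℚ₋∞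
    g j = M q j ⊔∞ fin (R j i)

    isM-prefix : ∀ {j} → j ≤ i → IsM R q j (M q j)
    isM-prefix j≤i = isM q _ 1≤q (ℕP.≤-trans j≤i (ℕP.m≤n⇒m≤1+n i≤n))

    isM-whole : IsM R (suc q) (suc i) (M (suc q) (suc i))
    isM-whole = isM (suc q) (suc i) (s≤s z≤n) (s≤s i≤n)

    M≤min : M (suc q) (suc i) ≤∞ minUpTo g i
    M≤min with minUpTo-attained g i
    ... | j , j≤i , min≡gj with proj₁ (isM-prefix j≤i)
    ...   | init , segs , len , maxR≡M =
      ≤∞-trans
        (proj₂ isM-whole (init ∷ʳ (j , i)) (SegsFrom-∷ʳ segs j≤i)
          (subst (_≤ suc q) (sym (length-∷ʳ init (j , i))) (s≤s len)))
        (≤∞-reflexive (trans (maxR-∷ʳ init j i)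
          (trans (cong (_⊔∞ fin (R j i)) maxR≡M) (sym min≡gj))))

    min≤M : minUpTo g i ≤∞ M (suc q) (suc i)
    min≤M with proj₁ isM-whole
    ... | seg ∷ segs , segsFrom , len , maxR≡M with SegsFrom-unsnoc segsFrom
    ...   | init , j , e , initFrom , j≤i =
      ≤∞-trans (minUpTo-≤ g j≤i)
        (≤∞-trans (⊔∞-lub (≤∞-trans M≤init (⊔∞-upperˡ (maxR R init) (fin (R j i))))
                          (⊔∞-upperʳ (maxR R init) (fin (R j i))))
          (≤∞-reflexive (trans (sym (maxR-∷ʳ init j i)) (trans (cong (maxR R) (sym e)) maxR≡M))))
      where
      M≤init : M q j ≤∞ maxR R init
      M≤init = proj₂ (isM-prefix j≤i) init initFrom
        (ℕP.≤-pred (subst (_≤ suc q) (trans (cong length e) (length-∷ʳ init (j , i))) len))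

-- If j₂ < j₁ were the largest minimiser at i + 1, then monotonicity of R under
-- interval inclusion would make j₁ at least as good at i + 1, contradicting maximality of j₂.
largestArgmin-mono : ∀ (A : ℕ → ℚ₋∞) (R : ℕ → ℕ → ℚ) {n i j₁ j₂} →
  (∀ {l′ l r r′} → l′ ≤ l → l ≤ r → r ≤ r′ → r′ ≤ n → ¬ ¬ (R l r ≤ℚ R l′ r′)) →
  suc i ≤ n →
  IsLargestArgmin (λ j → A j ⊔∞ fin (R j i)) i j₁ →
  IsLargestArgmin (λ j → A j ⊔∞ fin (R j (suc i))) (suc i) j₂ →
  j₁ ≤ j₂
largestArgmin-mono A R {i = i} {j₁} {j₂} R-mono 1+i≤n (j₁≤i , min₁ , _) (_ , min₂ , largest₂) =
  decidable-stable (j₁ ℕ.≤? j₂) λ j₁≰j₂ →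
    let j₂<j₁ = ℕP.≰⇒> j₁≰j₂
        j₁≤1+i = ℕP.m≤n⇒m≤1+n j₁≤i
        j₂≤i = ℕP.≤-trans (ℕP.<⇒≤ j₂<j₁) j₁≤i
    in R-mono (ℕP.<⇒≤ j₂<j₁) j₁≤1+i ℕP.≤-refl 1+i≤n λ shrinkˡ →
       R-mono ℕP.≤-refl j₂≤i (ℕP.n≤1+n i) 1+i≤n λ growʳ →
       largest₂ j₁ j₂<j₁ j₁≤1+i
         (≤∞-antisym (≤∞-trans (j₁-beats-j₂ j₂≤i shrinkˡ growʳ) (≤∞-reflexive min₂))
                     (minUpTo-≤ (g (suc i)) j₁≤1+i))
  where
  g : ℕ → ℕ → ℚ₋∞
  g m j = A j ⊔∞ fin (R j m)

  j₁-beats-j₂ : j₂ ≤ i → R j₁ (suc i) ≤ℚ R j₂ (suc i) → R j₂ i ≤ℚ R j₂ (suc i) →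
                g (suc i) j₁ ≤∞ g (suc i) j₂
  j₁-beats-j₂ j₂≤i shrinkˡ growʳ = ⊔∞-lub
    (≤∞-trans (⊔∞-upperˡ (A j₁) (fin (R j₁ i)))
      (≤∞-trans (≤∞-reflexive min₁)
        (≤∞-trans (minUpTo-≤ (g i) j₂≤i) (⊔∞-monoʳ-fin (A j₂) growʳ))))
    (≤∞-trans (fin≤ shrinkˡ) (⊔∞-upperʳ (A j₂) (fin (R j₂ (suc i)))))

NonNegUpTo : ℕ → (ℕ → ℚ) → Set
NonNegUpTo n s = ∀ j → j ≤ n → 0ℚ ≤ℚ s j

_≤[_]_ : (ℕ → ℚ) → ℕ → (ℕ → ℚ) → Set
s ≤[ n ] s′ = ∀ j → j ≤ n → s j ≤ℚ s′ j

m<n∸o⇒o+m<n : ∀ {m n o} → m < n ∸ o → o ℕ.+ m < n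
m<n∸o⇒o+m<n {m} {n} {o} m<n∸o =
  subst (o ℕ.+ m <_) (ℕP.m+[n∸m]≡n o≤n) (ℕP.+-monoʳ-< o m<n∸o)
  where
  o≤n : o ≤ n
  o≤n = ℕP.<⇒≤ (ℕP.m∸n≢0⇒n<m (λ n∸o≡0 → ℕP.n≮0 (subst (m <_) n∸o≡0 m<n∸o)))

maxRange-nonneg : ∀ f a c → 0ℚ ≤ℚ maxRange f a c
maxRange-nonneg f a zero    = ℚP.≤-refl
maxRange-nonneg f a (suc c) = ℚP.p≤q⇒p≤q⊔r (f (a ℕ.+ c)) (maxRange-nonneg f a c)

maxRange-upper : ∀ f {a b i} → a ≤ i → i < b → f i ≤ℚ maxRange f a (b ∸ a)
maxRange-upper f {a} {b} {i} a≤i i<b =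
  subst (λ j → f j ≤ℚ maxRange f a (b ∸ a)) (ℕP.m+[n∸m]≡n a≤i)
    (upper (b ∸ a) (ℕP.∸-monoˡ-< i<b a≤i))
  where
  upper : ∀ c {d} → d < c → f (a ℕ.+ d) ≤ℚ maxRange f a c
  upper (suc c) d<1+c with ℕP.m≤n⇒m<n∨m≡n d<1+c
  ... | inj₁ (s≤s d<c) = ℚP.p≤q⇒p≤q⊔r _ (upper c d<c)
  ... | inj₂ refl      = ℚP.p≤q⊔p (maxRange f a c) _

maxRange-lub : ∀ f {a b m} → 0ℚ ≤ℚ m → (∀ i → a ≤ i → i < b → f i ≤ℚ m) →
               maxRange f a (b ∸ a) ≤ℚ m
maxRange-lub f {a} {b} {m} 0≤m bound = lub (b ∸ a) λ d d<c → d<c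
  where
  lub : ∀ c → (∀ d → d < c → d < b ∸ a) → maxRange f a c ≤ℚ m
  lub zero    _     = 0≤m
  lub (suc c) inside = ℚP.⊔-lub (lub c (λ d d<c → inside d (ℕP.m≤n⇒m≤1+n d<c)))
    (bound (a ℕ.+ c) (ℕP.m≤m+n a c) (m<n∸o⇒o+m<n (inside c ℕP.≤-refl)))

sumCount-split : ∀ s a c d →
  sumCount s a (c ℕ.+ d) ≡ sumCount s a c ℚ.+ sumCount s (a ℕ.+ c) d
sumCount-split s a c zero rewrite ℕP.+-identityʳ c = sym (ℚP.+-identityʳ _)
sumCount-split s a c (suc d) rewrite ℕP.+-suc c d = begin
  sumCount s a (c ℕ.+ d) ℚ.+ s (a ℕ.+ (c ℕ.+ d))
    ≡⟨ cong₂ ℚ._+_ (sumCount-split s a c d) (cong s (sym (ℕP.+-assoc a c d))) ⟩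
  (sumCount s a c ℚ.+ sumCount s (a ℕ.+ c) d) ℚ.+ s (a ℕ.+ c ℕ.+ d)
    ≡⟨ ℚP.+-assoc (sumCount s a c) _ _ ⟩
  sumCount s a c ℚ.+ (sumCount s (a ℕ.+ c) d ℚ.+ s (a ℕ.+ c ℕ.+ d)) ∎
  where open ≡-Reasoning

sumRange≡prefix-difference : ∀ s {a b} → a ≤ suc b →
  sumRange s a b ≡ sumCount s 0 (suc b) ℚ.- sumCount s 0 a
sumRange≡prefix-difference s {a} {b} a≤1+b = begin
  sumRange s a b                                ≡⟨ sym (xyx⁻¹≈y (sumCount s 0 a) _) ⟩
  sumCount s 0 a ℚ.+ sumRange s a b ℚ.- sumCount s 0 a
    ≡⟨ cong (ℚ._- sumCount s 0 a) (sym (sumCount-split s 0 a (suc b ∸ a))) ⟩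
  sumCount s 0 (a ℕ.+ (suc b ∸ a)) ℚ.- sumCount s 0 a
    ≡⟨ cong (λ m → sumCount s 0 m ℚ.- sumCount s 0 a) (ℕP.m+[n∸m]≡n a≤1+b) ⟩
  sumCount s 0 (suc b) ℚ.- sumCount s 0 a       ∎
  where open ≡-Reasoning

prefixSum-mono : ∀ {n s m m′} → NonNegUpTo n s → m ≤ m′ → m′ ≤ suc n →
                 sumCount s 0 m ≤ℚ sumCount s 0 m′
prefixSum-mono {m′ = zero}   _      z≤n   _         = ℚP.≤-refl
prefixSum-mono {s = s} {m′ = suc m′} nonneg m≤1+m′ 1+m′≤1+n
  with ℕP.m≤n⇒m<n∨m≡n m≤1+m′
... | inj₂ refl       = ℚP.≤-refl
... | inj₁ (s≤s m≤m′) =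
  ℚP.≤-trans (prefixSum-mono nonneg m≤m′ (ℕP.m≤n⇒m≤1+n m′≤n)) (begin
    sumCount s 0 m′          ≡⟨ sym (ℚP.+-identityʳ _) ⟩
    sumCount s 0 m′ ℚ.+ 0ℚ   ≤⟨ ℚP.+-monoʳ-≤ (sumCount s 0 m′) (nonneg m′ m′≤n) ⟩
    sumCount s 0 (suc m′)    ∎)
  where
  open ℚP.≤-Reasoning
  m′≤n = ℕP.≤-pred 1+m′≤1+n

sumCount-mono : ∀ {s s′} a c → (∀ d → d < c → s (a ℕ.+ d) ≤ℚ s′ (a ℕ.+ d)) →
                 sumCount s a c ≤ℚ sumCount s′ a c
sumCount-mono a zero    _  = ℚP.≤-refl
sumCount-mono a (suc c) s≤s′ =
  ℚP.+-mono-≤ (sumCount-mono a c (λ d d<c → s≤s′ d (ℕP.m≤n⇒m≤1+n d<c))) (s≤s′ c ℕP.≤-refl)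

sumRange-mono : ∀ {n s s′ a′ a b b′} → NonNegUpTo n s′ → s ≤[ n ] s′ →
  a′ ≤ a → a ≤ b → b ≤ b′ → b′ ≤ n → sumRange s a b ≤ℚ sumRange s′ a′ b′
sumRange-mono {n} {s} {s′} {a′} {a} {b} {b′} nonneg s≤s′ a′≤a a≤b b≤b′ b′≤n = begin
  sumRange s a b
    ≤⟨ sumCount-mono a (suc b ∸ a) (λ d d<c →
         s≤s′ _ (ℕP.≤-trans (ℕP.≤-pred (m<n∸o⇒o+m<n d<c)) (ℕP.≤-trans b≤b′ b′≤n))) ⟩
  sumRange s′ a b
    ≡⟨ sumRange≡prefix-difference s′ (ℕP.m≤n⇒m≤1+n a≤b) ⟩
  sumCount s′ 0 (suc b) ℚ.- sumCount s′ 0 a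
    ≤⟨ ℚP.+-mono-≤ (prefixSum-mono nonneg (s≤s b≤b′) (s≤s b′≤n))
                   (ℚP.neg-antimono-≤ (prefixSum-mono nonneg a′≤a a≤n)) ⟩
  sumCount s′ 0 (suc b′) ℚ.- sumCount s′ 0 a′
    ≡⟨ sym (sumRange≡prefix-difference s′ a′≤1+b′) ⟩
  sumRange s′ a′ b′ ∎
  where
  open ℚP.≤-Reasoning
  a≤n = ℕP.≤-trans (ℕP.≤-trans a≤b b≤b′) (ℕP.m≤n⇒m≤1+n b′≤n)
  a′≤1+b′ = ℕP.≤-trans a′≤a (ℕP.≤-trans a≤b (ℕP.≤-trans b≤b′ (ℕP.n≤1+n b′)))

¬¬-maximum : ∀ {A : Set} (P : A → Set) (v : A → ℚ) xs → Any P xs →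
  ¬ ¬ (∃[ a ] (P a × All (λ b → P b → v b ≤ℚ v a) xs))
¬¬-maximum P v (x ∷ xs) hit = ¬¬-excluded-middle >>= extend
  where
  extend : Dec (Any P xs) → ¬ ¬ (∃[ a ] (P a × All (λ b → P b → v b ≤ℚ v a) (x ∷ xs)))
  extend (no none) = pure (x , head-holds hit , (λ _ → ℚP.≤-refl) ∷
                          All.map (λ ¬pb pb → ⊥-elim (¬pb pb)) (¬Any⇒All¬ xs none))
    where
    head-holds : Any P (x ∷ xs) → P x
    head-holds (here px)    = px
    head-holds (there some) = ⊥-elim (none some)
  extend (yes some) = do
    (a , pa , maximal) ← ¬¬-maximum P v xs some
    px? ← ¬¬-excluded-middle
    pure (with-head px? a pa maximal)
    where
    with-head : Dec (P x) → ∀ a → P a → All (λ b → P b → v b ≤ℚ v a) xs →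
                ∃[ a ] (P a × All (λ b → P b → v b ≤ℚ v a) (x ∷ xs))
    with-head (no ¬px) a pa maximal = a , pa , (λ px → ⊥-elim (¬px px)) ∷ maximal
    with-head (yes px) a pa maximal with ℚP.≤-total (v x) (v a)
    ... | inj₁ vx≤va = a , pa , (λ _ → vx≤va) ∷ maximal
    ... | inj₂ va≤vx =
      x , px , (λ _ → ℚP.≤-refl) ∷ All.map (λ h pb → ℚP.≤-trans (h pb) va≤vx) maximal

AgreeBelow : ℕ → (ℕ → Bool) → (ℕ → Bool) → Set
AgreeBelow m f g = ∀ j → j < m → f j ≡ g j

_◂_ : Bool → (ℕ → Bool) → ℕ → Bool
(b ◂ f) zero    = b
(b ◂ f) (suc j) = f j

patterns : ℕ → List (ℕ → Bool)
patterns zero    = [ const false ]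
patterns (suc m) = map (true ◂_) (patterns m) ++ map (false ◂_) (patterns m)

patterns-complete : ∀ m g → Any (AgreeBelow m g) (patterns m)
patterns-complete zero    g = here (λ _ ())
patterns-complete (suc m) g =
  with-head (g zero) (map⁺ (Any.map cons-head (patterns-complete m (g ∘ suc))))
  where
  cons-head : ∀ {f} → AgreeBelow m (g ∘ suc) f → AgreeBelow (suc m) g (g zero ◂ f)
  cons-head agree zero    _         = refl
  cons-head agree (suc j) (s≤s j<m) = agree j j<m

  with-head : ∀ b → Any (AgreeBelow (suc m) g) (map (b ◂_) (patterns m)) →
              Any (AgreeBelow (suc m) g) (patterns (suc m))
  with-head true  = ++⁺ˡ
  with-head false = ++⁺ʳ (map (true ◂_) (patterns m))

sink-clamp : ∀ {l r} t′ → l ≤ r →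
  ∃[ t ] (l ≤ t × t ≤ r × (l < t → t ≤ t′) × (t < r → t′ ≤ t))
sink-clamp {l} {r} t′ l≤r with t′ ℕ.<? l | r ℕ.<? t′
... | yes t′<l | _        = l , ℕP.≤-refl , l≤r , (λ l<l → ⊥-elim (ℕP.<-irrefl refl l<l)) ,
                            (λ _ → ℕP.<⇒≤ t′<l)
... | no _     | yes r<t′ = r , l≤r , ℕP.≤-refl , (λ _ → ℕP.<⇒≤ r<t′) ,
                            (λ r<r → ⊥-elim (ℕP.<-irrefl refl r<r))
... | no t′≮l  | no r≮t′  = t′ , ℕP.≮⇒≥ t′≮l , ℕP.≮⇒≥ r≮t′ , (λ _ → ℕP.≤-refl) , (λ _ → ℕP.≤-refl)

module Instance (n k : ℕ) (x : ℕ → ℚ) (τ : ℚ) (wm wp : ℕ → ℚ)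
  (x-increasing : ∀ i → i < n → x i <ℚ x (suc i)) (τ-positive : 0ℚ <ℚ τ)
  (weights : ∀ i → i ≤ n → (0ℚ <ℚ wm i × wm i ≤ℚ wp i)) where
  open Setup n k x τ wm wp

  x-mono : ∀ {i j} → i ≤ j → j ≤ n → x i ≤ℚ x j
  x-mono {j = zero}  z≤n   _   = ℚP.≤-refl
  x-mono {j = suc j} i≤1+j 1+j≤n with ℕP.m≤n⇒m<n∨m≡n i≤1+j
  ... | inj₂ refl      = ℚP.≤-refl
  ... | inj₁ (s≤s i≤j) = ℚP.≤-trans (x-mono i≤j (ℕP.<⇒≤ 1+j≤n)) (ℚP.<⇒≤ (x-increasing j 1+j≤n))

  private instance
    τ-nonNeg : ℚ.NonNegative τ
    τ-nonNeg = ℚ.nonNegative (ℚP.<⇒≤ τ-positive)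

  travel-monoˡ : ∀ {p q} r → p ≤ℚ q → (p ℚ.- r) ℚ.* τ ≤ℚ (q ℚ.- r) ℚ.* τ
  travel-monoˡ r p≤q = ℚP.*-monoʳ-≤-nonNeg τ (ℚP.+-monoˡ-≤ (ℚ.- r) p≤q)

  travel-antitoneʳ : ∀ {p q} r → p ≤ℚ q → (r ℚ.- q) ℚ.* τ ≤ℚ (r ℚ.- p) ℚ.* τ
  travel-antitoneʳ r p≤q = ℚP.*-monoʳ-≤-nonNeg τ (ℚP.+-monoʳ-≤ r (ℚP.neg-antimono-≤ p≤q))

  ΘL-mono : ∀ {s s′ l′ l t t′} → NonNegUpTo n s′ → s ≤[ n ] s′ →
    l′ ≤ l → (l < t → t ≤ t′) → t′ ≤ n → ΘL l t s ≤ℚ ΘL l′ t′ s′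
  ΘL-mono {l′ = l′} {t′ = t′} nonneg s≤s′ l′≤l sink-right t′≤n =
    maxRange-lub _ (maxRange-nonneg _ l′ (t′ ∸ l′)) λ i l≤i i<t →
      let t≤t′ = sink-right (ℕP.≤-<-trans l≤i i<t)
          i≤n  = ℕP.<⇒≤ (ℕP.<-≤-trans i<t (ℕP.≤-trans t≤t′ t′≤n))
      in ℚP.≤-trans
           (ℚP.+-mono-≤ (travel-monoˡ (x i) (x-mono t≤t′ t′≤n))
                        (sumRange-mono nonneg s≤s′ l′≤l l≤i ℕP.≤-refl i≤n))
           (maxRange-upper _ (ℕP.≤-trans l′≤l l≤i) (ℕP.<-≤-trans i<t t≤t′))

  ΘR-mono : ∀ {s s′ t′ t r r′} → NonNegUpTo n s′ → s ≤[ n ] s′ →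
    (t < r → t′ ≤ t) → r ≤ r′ → r′ ≤ n → ΘR t r s ≤ℚ ΘR t′ r′ s′
  ΘR-mono {t′ = t′} {r′ = r′} nonneg s≤s′ sink-left r≤r′ r′≤n =
    maxRange-lub _ (maxRange-nonneg _ (suc t′) (r′ ∸ t′)) λ i t<i i≤r →
      let t<r  = ℕP.<-≤-trans t<i (ℕP.≤-pred i≤r)
          t′≤t = sink-left t<r
          r≤n  = ℕP.≤-trans r≤r′ r′≤n
      in ℚP.≤-trans
           (ℚP.+-mono-≤ (travel-antitoneʳ (x i) (x-mono t′≤t (ℕP.<⇒≤ (ℕP.<-≤-trans t<r r≤n))))
                        (sumRange-mono nonneg s≤s′ ℕP.≤-refl (ℕP.≤-pred i≤r) r≤r′ r′≤n))
           (maxRange-upper _ (ℕP.≤-trans (s≤s t′≤t) t<i) (ℕP.<-≤-trans i≤r (s≤s r≤r′)))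

  Θ1-mono : ∀ {s s′ l′ l t t′ r r′} → NonNegUpTo n s′ → s ≤[ n ] s′ →
    l′ ≤ l → r ≤ r′ → (l < t → t ≤ t′) → (t < r → t′ ≤ t) → t′ ≤ n → r′ ≤ n →
    Θ1 (l , r , t) s ≤ℚ Θ1 (l′ , r′ , t′) s′
  Θ1-mono nonneg s≤s′ l′≤l r≤r′ sink-right sink-left t′≤n r′≤n =
    ℚP.⊔-mono-≤ (ΘL-mono nonneg s≤s′ l′≤l sink-right t′≤n)
                (ΘR-mono nonneg s≤s′ sink-left r≤r′ r′≤n)

  scenario-nonneg : ∀ {s} → IsScenario s → NonNegUpTo n s
  scenario-nonneg sc j j≤n = ℚP.≤-trans (ℚP.<⇒≤ (proj₁ (weights j j≤n))) (proj₁ (sc j j≤n))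

  Agree : Scenario → Scenario → Set
  Agree s s′ = ∀ j → j ≤ n → s j ≡ s′ j

  Θ1-cong : ∀ {s s′ l r t} → IsScenario s → IsScenario s′ → Agree s s′ → t ≤ n → r ≤ n →
            Θ1 (l , r , t) s ≡ Θ1 (l , r , t) s′
  Θ1-cong {l = l} {r} {t} sc sc′ agree t≤n r≤n = ℚP.≤-antisym
    (Θ1-≤ sc′ (λ j j≤n → ℚP.≤-reflexive (agree j j≤n)))
    (Θ1-≤ sc  (λ j j≤n → ℚP.≤-reflexive (sym (agree j j≤n))))
    where
    Θ1-≤ : ∀ {s s′} → IsScenario s′ → s ≤[ n ] s′ → Θ1 (l , r , t) s ≤ℚ Θ1 (l , r , t) s′
    Θ1-≤ sc′ s≤s′ = Θ1-mono {l′ = l} {t′ = t} {r′ = r} (scenario-nonneg sc′) s≤s′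
                      ℕP.≤-refl ℕP.≤-refl (λ _ → ℕP.≤-refl) (λ _ → ℕP.≤-refl) t≤n r≤n

  Θk-cong : ∀ {s s′ l ps} → IsScenario s → IsScenario s′ → Agree s s′ → PartsFrom l ps →
            Θk ps s ≡ Θk ps s′
  Θk-cong sc sc′ agree (lastPart {l} _ t≤n) =
    cong (ℚ._⊔ 0ℚ) (Θ1-cong {l = l} sc sc′ agree t≤n ℕP.≤-refl)
  Θk-cong sc sc′ agree (consPart {l} _ t≤r r<n rest) = cong₂ ℚ._⊔_
    (Θ1-cong {l = l} sc sc′ agree (ℕP.≤-trans t≤r (ℕP.<⇒≤ r<n)) (ℕP.<⇒≤ r<n))
    (Θk-cong sc sc′ agree rest)

  IsOpt-unique : ∀ {s s′ v v′} → IsScenario s → IsScenario s′ → Agree s s′ →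
                 IsOpt s v → IsOpt s′ v′ → v ≡ v′
  IsOpt-unique sc sc′ agree isOpt isOpt′ = ℚP.≤-antisym
    (opt-≤ sc sc′ agree isOpt isOpt′) (opt-≤ sc′ sc (λ j j≤n → sym (agree j j≤n)) isOpt′ isOpt)
    where
    opt-≤ : ∀ {s s′ v v′} → IsScenario s → IsScenario s′ → Agree s s′ →
            IsOpt s v → IsOpt s′ v′ → v ≤ℚ v′
    opt-≤ sc sc′ agree (_ , minimal) ((ps′ , partition′ , Θk≡v′) , _) =
      ℚP.≤-trans (minimal ps′ partition′)
        (ℚP.≤-reflexive (trans (Θk-cong sc sc′ agree (proj₁ partition′)) Θk≡v′))

  TwoValued : Scenario → Set
  TwoValued s = ∀ j → j ≤ n → s j ≡ wm j ⊎ s j ≡ wp j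

  twoValued⇒scenario : ∀ {s} → TwoValued s → IsScenario s
  twoValued⇒scenario twoValued j j≤n with twoValued j j≤n
  ... | inj₁ s≡wm rewrite s≡wm = ℚP.≤-refl , proj₂ (weights j j≤n)
  ... | inj₂ s≡wp rewrite s≡wp = proj₂ (weights j j≤n) , ℚP.≤-refl

  choose : (ℕ → Bool) → Scenario
  choose f j = if f j then wp j else wm j

  choose-twoValued : ∀ f → TwoValued (choose f)
  choose-twoValued f j _ with f j
  ... | true  = inj₂ refl
  ... | false = inj₁ refl

  patternOf : Scenario → ℕ → Bool
  patternOf s j = does (s j ℚ.≟ wp j)

  choose-patternOf : ∀ {s f} → TwoValued s → AgreeBelow (suc n) (patternOf s) f →
                     Agree s (choose f)
  choose-patternOf {s} twoValued agree j j≤n rewrite sym (agree j (s≤s j≤n))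
    with s j ℚ.≟ wp j | twoValued j j≤n
  ... | yes s≡wp | _          = s≡wp
  ... | no  _    | inj₁ s≡wm  = s≡wm
  ... | no  s≢wp | inj₂ s≡wp  = ⊥-elim (s≢wp s≡wp)

  ¬¬-maximum-twoValued : (Q : Scenario → Set) (v : Scenario → ℚ) →
    (∀ {s} → Q s → TwoValued s) →
    (∀ {s s′} → IsScenario s → IsScenario s′ → Agree s s′ → v s ≡ v s′) →
    ∀ {s₀} → Q s₀ → ¬ ¬ (∃[ u ] ((∃[ s ] (Q s × v s ≡ u)) × (∀ s → Q s → v s ≤ℚ u)))
  ¬¬-maximum-twoValued Q v twoValued v-cong {s₀} q₀ = do
      (f , (s , qs , agree) , maximal) ← ¬¬-maximum Represented (v ∘ choose) candidates
                                                      (Any.map (represented q₀) (covered s₀))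
      pure (v (choose f) , (s , qs , v-cong (scenario qs) (chosen f) agree) , bound f maximal)
    where
    candidates = patterns (suc n)

    Represented : (ℕ → Bool) → Set
    Represented f = ∃[ s ] (Q s × Agree s (choose f))

    scenario : ∀ {s} → Q s → IsScenario s
    scenario qs = twoValued⇒scenario (twoValued qs)

    chosen : ∀ f → IsScenario (choose f)
    chosen f = twoValued⇒scenario (choose-twoValued f)

    covered : ∀ s → Any (AgreeBelow (suc n) (patternOf s)) candidates
    covered s = patterns-complete (suc n) (patternOf s)

    represented : ∀ {s f} → Q s → AgreeBelow (suc n) (patternOf s) f → Represented f
    represented qs agree = _ , qs , choose-patternOf (twoValued qs) agree

    bound : ∀ f → All (λ g → Represented g → v (choose g) ≤ℚ v (choose f)) candidates →
            ∀ s → Q s → v s ≤ℚ v (choose f)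
    bound f maximal s qs with lookupAny maximal (covered s)
    ... | below , agree = ℚP.≤-trans
      (ℚP.≤-reflexive (v-cong (scenario qs) (chosen _) (choose-patternOf (twoValued qs) agree)))
      (below (represented qs agree))

  module _ (opt : Scenario → ℚ) (isOpt : ∀ s → IsScenario s → IsOpt s (opt s)) where
    open WithOpt opt

    Rlrs-cong : ∀ {s s′ l r t} → IsScenario s → IsScenario s′ → Agree s s′ → t ≤ n → r ≤ n →
                Rlrs l r s t ≡ Rlrs l r s′ t
    Rlrs-cong {s} {s′} {l} sc sc′ agree t≤n r≤n = cong₂ ℚ._-_ (Θ1-cong {l = l} sc sc′ agree t≤n r≤n)
      (IsOpt-unique sc sc′ agree (isOpt s sc) (isOpt s′ sc′))

    dominant-twoValued : ∀ {l r s} → LeftDominant l r s ⊎ RightDominant l r s →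
      ∀ j → l ≤ j → j ≤ r → s j ≡ wm j ⊎ s j ≡ wp j
    dominant-twoValued (inj₁ (i , _ , _ , high , low)) j l≤j j≤r with j ℕ.<? i
    ... | yes j<i = inj₂ (high j l≤j j<i)
    ... | no  j≮i = inj₁ (low j (ℕP.≮⇒≥ j≮i) j≤r)
    dominant-twoValued (inj₂ (i , _ , _ , low , high)) j l≤j j≤r with j ℕ.<? i
    ... | yes j<i = inj₁ (low j l≤j j<i)
    ... | no  j≮i = inj₂ (high j (ℕP.≮⇒≥ j≮i) j≤r)

    Sstar-twoValued : ∀ {s} → InSstar s → TwoValued s
    Sstar-twoValued (_ , _ , _ , _ , l , r , _ , _ , outside , dominant) j j≤n
      with j ℕ.<? l | r ℕ.<? j
    ... | yes j<l | _        = inj₁ (outside j j≤n (inj₁ j<l))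
    ... | no _    | yes r<j  = inj₁ (outside j j≤n (inj₂ r<j))
    ... | no j≮l  | no r≮j   = dominant-twoValued dominant j (ℕP.≮⇒≥ j≮l) (ℕP.≮⇒≥ r≮j)

    ¬¬-Rlrt-exists : ∀ {l r t s₀} → t ≤ n → r ≤ n → InSstar s₀ → ¬ ¬ (∃[ u ] IsRlrt l r t u)
    ¬¬-Rlrt-exists {l} {r} {t} t≤n r≤n =
      ¬¬-maximum-twoValued InSstar (λ s → Rlrs l r s t) Sstar-twoValued
        (λ sc sc′ agree → Rlrs-cong {l = l} sc sc′ agree t≤n r≤n)

    R-mono : (R : ℕ → ℕ → ℚ) → (∀ l r → l ≤ r → r ≤ n → IsRlr l r (R l r)) →
      ∀ {l′ l r r′} → l′ ≤ l → l ≤ r → r ≤ r′ → r′ ≤ n → ¬ ¬ (R l r ≤ℚ R l′ r′)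
    R-mono R isR {l′} {l} {r} {r′} l′≤l l≤r r≤r′ r′≤n
      with isR l′ r′ (ℕP.≤-trans l′≤l (ℕP.≤-trans l≤r r≤r′)) r′≤n
    ... | (t′ , _ , t′≤r′ , (_ , s₀∈S* , _) , R′-max) , _ with sink-clamp t′ l≤r
    ... | t , l≤t , t≤r , sink-right , sink-left = do
      (u , isRlrt@((s , s∈S* , Rlrs≡u) , _)) ←
        ¬¬-Rlrt-exists {l} {r} {t} (ℕP.≤-trans t≤r r≤n) r≤n s₀∈S*
      let sc = twoValued⇒scenario (Sstar-twoValued s∈S*)
          Θ1-≤ = Θ1-mono (scenario-nonneg sc) (λ _ _ → ℚP.≤-refl) l′≤l r≤r′
                         sink-right sink-left (ℕP.≤-trans t′≤r′ r′≤n) r′≤n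
      pure (begin
        R l r                 ≤⟨ proj₂ (isR l r l≤r r≤n) t u l≤t t≤r isRlrt ⟩
        u                     ≡⟨ sym Rlrs≡u ⟩
        Rlrs l r s t          ≤⟨ ℚP.+-monoˡ-≤ (ℚ.- opt s) Θ1-≤ ⟩
        Rlrs l′ r′ s t′       ≤⟨ R′-max s s∈S* ⟩
        R l′ r′               ∎)
      where
      open ℚP.≤-Reasoning
      r≤n = ℕP.≤-trans r≤r′ r′≤n


mainTheorem15 :
  (n k : ℕ) (x : ℕ → ℚ) (τ : ℚ) (wm wp : ℕ → ℚ) →
  (∀ i → i < n → x i <ℚ x (suc i)) →
  0ℚ <ℚ τ →
  (∀ i → i ≤ n → (0ℚ <ℚ wm i × wm i ≤ℚ wp i)) →
  1 ≤ k → k ≤ suc n →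
  (opt : (ℕ → ℚ) → ℚ) →
  (∀ s → Setup.IsScenario n k x τ wm wp s → Setup.IsOpt n k x τ wm wp s (opt s)) →
  (R : ℕ → ℕ → ℚ) →
  (∀ l r → l ≤ r → r ≤ n → Setup.WithOpt.IsRlr n k x τ wm wp opt l r (R l r)) →
  (M : ℕ → ℕ → ℚ₋∞) →
  (∀ q m → 1 ≤ q → m ≤ suc n → Setup.WithOpt.IsM n k x τ wm wp opt R q m (M q m)) →
  (q : ℕ) → 2 ≤ q →
  ((∀ i → i ≤ n →
      M q (suc i) ≡ minUpTo (λ j → M (pred q) j ⊔∞ fin (R j i)) i) ×
   (∀ i j₁ j₂ → suc i ≤ n →
      IsLargestArgmin (λ j → M (pred q) j ⊔∞ fin (R j i)) i j₁ →
      IsLargestArgmin (λ j → M (pred q) j ⊔∞ fin (R j (suc i))) (suc i) j₂ →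
      j₁ ≤ j₂))
mainTheorem15 n k x τ wm wp x-increasing τ-positive weights _ _ opt isOpt R isR M isM
              (suc q) (s≤s 1≤q) =
  (λ i i≤n → M-recurrence n k x τ wm wp opt R M isM 1≤q i≤n) ,
  (λ i j₁ j₂ → largestArgmin-mono (M q) R (R-mono opt isOpt R isR))
  where open Instance n k x τ wm wp x-increasing τ-positive weights
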